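{- If $\mathbb{C}$ is a complete m-algebra (resp.~c-algebra), then $\mathbb{C} \cong (\mathbb{C}^\bullet)_\bullet$. Moreover, if $\mathbb{H}$ is a complete supported heterogeneous m-algebra (resp.~c-algebra), then $\mathbb{H}\cong \mathbb{C}^\bullet$ for some complete m-algebra (resp.~c-algebra) $\mathbb{C}$ iff $\mathbb{H} \cong (\mathbb{H}_\bullet)^\bullet$.
   Context: An m-algebra is a pair $(\mathbb{A},\nabla)$ with $\mathbb{A}$ a Boolean algebra and $\nabla$ a unary monotone operation on it; a c-algebra is a pair $(\mathbb{A},>)$ with $>$ a binary operation finitely meet-preserving in its second coordinate. Such an algebra is complete if $\mathbb{A}$ is a complete Boolean algebra (and, for c-algebras, $>$ is completely meet-preserving in its second coordinate). A heterogeneous m-algebra is $\mathbb{H}=(\mathbb{A},\mathbb{B},[\ni],\langle\not\ni\rangle,\langle\nu\rangle,[\nu^c])$ with $\mathbb{A},\mathbb{B}$ Boolean algebras, $\langle\nu\rangle,[\nu^c]:\mathbb{B}\to\mathbb{A}$ finitely join-preserving resp.~finitely meet-preserving, $[\ni],\langle\not\ni\rangle:\mathbb{A}\to\mathbb{B}$ finitely meet-preserving resp.~finitely join-preserving; a heterogeneous c-algebra is $\mathbb{H}=(\mathbb{A},\mathbb{B},[\ni],[\not\ni\rangle,\vartriangleright)$ with $[\ni]:\mathbb{A}\to\mathbb{B}$ finitely meet-preserving, $[\not\ni\rangle:\mathbb{A}\to\mathbb{B}$ finitely join-reversing, $\vartriangleright:\mathbb{B}\times\mathbb{A}\to\mathbb{A}$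 finitely join-reversing in the first and finitely meet-preserving in the second coordinate. $\mathbb{H}$ is complete if $\mathbb{A},\mathbb{B}$ are complete and these preservation properties hold for arbitrary joins/meets. A heterogeneous m-algebra is supported if $\langle\nu\rangle[\ni]a=[\nu^c]\langle\not\ni\rangle a$ for all $a\in\mathbb{A}$. For a supported heterogeneous m-algebra (resp.~c-algebra) $\mathbb{H}$, $\mathbb{H}_\bullet:=(\mathbb{A},\nabla^{\mathbb{H}_\bullet})$ with $\nabla^{\mathbb{H}_\bullet}a=\langle\nu\rangle[\ni]a=[\nu^c]\langle\not\ni\rangle a$ (resp.~$\mathbb{H}_\bullet:=(\mathbb{A},>^{\mathbb{H}_\bullet})$ with $a>^{\mathbb{H}_\bullet}b=([\ni]a\wedge[\not\ni\rangle a)\vartriangleright b$). For a complete m-algebra (resp.~c-algebra) $\mathbb{C}=(\mathbb{A},\nabla)$ (resp.~$(\mathbb{A},>)$), $\mathbb{C}^\bullet$ has domains $\mathbb{A}$ and $\mathcal{P}(\mathbb{A})$ with, for $a\in\mathbb{A}$, $B\subseteq\mathbb{A}$: $[\ni]a=\{b\mid b\le a\}$, $\langle\not\ni\rangle a=\{b\mid a\nleq b\}$, $[\not\ni\rangle a=\{b\mid a\le b\}$, $\langle\nu\rangle B=\bigvee\{\nabla b\mid b\in B\}$, $[\nu^c]B=\bigwedge\{\nabla b\mid b\notin B\}$, $B\vartriangleright a=\bigwedge\{b>a\mid b\in B\}$. -}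

module Defs where

open import Level using (Level; _⊔_; suc)
open import Data.Product using (Σ; _×_; _,_; proj₁; proj₂)
open import Data.Sum using (_⊎_)
import Data.Sum as Sum
open import Data.Unit.Polymorphic using () renaming (⊤ to ⊤ℓ)
open import Data.Empty.Polymorphic using () renaming (⊥ to ⊥ℓ)
open import Relation.Nullary using () renaming (¬_ to Not)
open import Algebra.Lattice.Bundles using (BooleanAlgebra)

record CBA (c e i : Level) : Set (suc (c ⊔ e ⊔ i)) where
  field
    ba : BooleanAlgebra c e
  open BooleanAlgebra ba public

  _≤_ : Carrier → Carrier → Set e
  x ≤ y = (x ∧ y) ≈ x

  field
    ⋁      : {I : Set i} → (I → Carrier) → Carrier
    ⋁-ub   : {I : Set i} (f : I → Carrier) (k : I) → f k ≤ ⋁ f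
    ⋁-least : {I : Set i} (f : I → Carrier) (x : Carrier) →
              ((k : I) → f k ≤ x) → ⋁ f ≤ x
    ⋀      : {I : Set i} → (I → Carrier) → Carrier
    ⋀-lb   : {I : Set i} (f : I → Carrier) (k : I) → ⋀ f ≤ f k
    ⋀-greatest : {I : Set i} (f : I → Carrier) (x : Carrier) →
              ((k : I) → x ≤ f k) → x ≤ ⋀ f

  ≤-respˡ : ∀ {x y a} → x ≈ y → x ≤ a → y ≤ a
  ≤-respˡ x≈y x≤a = trans (∧-cong (sym x≈y) refl) (trans x≤a x≈y)

  ≤-respʳ : ∀ {a y z} → y ≈ z → a ≤ y → a ≤ z
  ≤-respʳ y≈z a≤y = trans (∧-cong refl (sym y≈z)) a≤y

record RawBA (c e : Level) : Set (suc (c ⊔ e)) where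
  infix 4 _≈_
  field
    Carrier : Set c
    _≈_     : Carrier → Carrier → Set e
    _∧_ _∨_ : Carrier → Carrier → Carrier
    ¬_      : Carrier → Carrier
    ⊤ ⊥     : Carrier

rawBA : ∀ {c e i} → CBA c e i → RawBA c e
rawBA A = record
  { Carrier = Carrier ; _≈_ = _≈_ ; _∧_ = _∧_ ; _∨_ = _∨_ ; ¬_ = ¬_ ; ⊤ = ⊤ ; ⊥ = ⊥ }
  where open CBA A

record BAIso {c e c' e'} (R : RawBA c e) (S : RawBA c' e')
       : Set (c ⊔ e ⊔ c' ⊔ e') where
  module R = RawBA R
  module S = RawBA S
  field
    to        : R.Carrier → S.Carrier
    from      : S.Carrier → R.Carrier
    to-cong   : ∀ {x y} → x R.≈ y → to x S.≈ to y
    from-cong : ∀ {x y} → x S.≈ y → from x R.≈ from y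
    to-from   : ∀ y → to (from y) S.≈ y
    from-to   : ∀ x → from (to x) R.≈ x
    to-∧      : ∀ x y → to (x R.∧ y) S.≈ (to x S.∧ to y)
    to-∨      : ∀ x y → to (x R.∨ y) S.≈ (to x S.∨ to y)
    to-¬      : ∀ x → to (R.¬ x) S.≈ (S.¬ (to x))
    to-⊤      : to R.⊤ S.≈ S.⊤
    to-⊥      : to R.⊥ S.≈ S.⊥

record CompleteMAlg (ℓ : Level) : Set (suc ℓ) where
  field
    A : CBA ℓ ℓ ℓ
  open CBA A
  field
    ∇      : Carrier → Carrier
    ∇-cong : ∀ {x y} → x ≈ y → ∇ x ≈ ∇ y
    ∇-mono : ∀ {x y} → x ≤ y → ∇ x ≤ ∇ y

record CompleteCAlg (ℓ : Level) : Set (suc ℓ) where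
  field
    A : CBA ℓ ℓ ℓ
  open CBA A
  field
    _>_     : Carrier → Carrier → Carrier
    >-cong  : ∀ {x x' y y'} → x ≈ x' → y ≈ y' → (x > y) ≈ (x' > y')
    >-⋀     : ∀ {I : Set ℓ} (a : Carrier) (f : I → Carrier) →
              (a > ⋀ f) ≈ ⋀ (λ k → a > f k)

record RawMAlg (c e : Level) : Set (suc (c ⊔ e)) where
  field
    A : RawBA c e
  open RawBA A
  field
    ∇ : Carrier → Carrier

record RawCAlg (c e : Level) : Set (suc (c ⊔ e)) where
  field
    A : RawBA c e
  open RawBA A
  field
    _>_ : Carrier → Carrier → Carrier

rawM : ∀ {ℓ} → CompleteMAlg ℓ → RawMAlg ℓ ℓ
rawM C = record { A = rawBA (CompleteMAlg.A C) ; ∇ = CompleteMAlg.∇ C }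

rawC : ∀ {ℓ} → CompleteCAlg ℓ → RawCAlg ℓ ℓ
rawC C = record { A = rawBA (CompleteCAlg.A C) ; _>_ = CompleteCAlg._>_ C }

record MIso {c e c' e'} (C : RawMAlg c e) (D : RawMAlg c' e')
       : Set (c ⊔ e ⊔ c' ⊔ e') where
  module C = RawMAlg C
  module D = RawMAlg D
  field
    iso : BAIso C.A D.A
  open BAIso iso
  field
    to-∇ : ∀ x → to (C.∇ x) S.≈ D.∇ (to x)

record CIso {c e c' e'} (C : RawCAlg c e) (D : RawCAlg c' e')
       : Set (c ⊔ e ⊔ c' ⊔ e') where
  module C = RawCAlg C
  module D = RawCAlg D
  field
    iso : BAIso C.A D.A
  open BAIso iso
  field
    to-> : ∀ x y → to (x C.> y) S.≈ (to x D.> to y)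

record CompleteHetMAlg (ℓ b₁ b₂ : Level) : Set (suc (ℓ ⊔ b₁ ⊔ b₂)) where
  field
    A : CBA ℓ ℓ ℓ
    B : CBA b₁ b₂ ℓ
  module A = CBA A
  module B = CBA B
  field
    [∋]  : A.Carrier → B.Carrier
    ⟨∌⟩  : A.Carrier → B.Carrier
    ⟨ν⟩  : B.Carrier → A.Carrier
    [νᶜ] : B.Carrier → A.Carrier
    [∋]-cong  : ∀ {x y} → x A.≈ y → [∋] x B.≈ [∋] y
    ⟨∌⟩-cong  : ∀ {x y} → x A.≈ y → ⟨∌⟩ x B.≈ ⟨∌⟩ y
    ⟨ν⟩-cong  : ∀ {x y} → x B.≈ y → ⟨ν⟩ x A.≈ ⟨ν⟩ y
    [νᶜ]-cong : ∀ {x y} → x B.≈ y → [νᶜ] x A.≈ [νᶜ] y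
    [∋]-⋀  : ∀ {I : Set ℓ} (f : I → A.Carrier) →
             [∋] (A.⋀ f) B.≈ B.⋀ (λ k → [∋] (f k))
    ⟨∌⟩-⋁  : ∀ {I : Set ℓ} (f : I → A.Carrier) →
             ⟨∌⟩ (A.⋁ f) B.≈ B.⋁ (λ k → ⟨∌⟩ (f k))
    ⟨ν⟩-⋁  : ∀ {I : Set ℓ} (f : I → B.Carrier) →
             ⟨ν⟩ (B.⋁ f) A.≈ A.⋁ (λ k → ⟨ν⟩ (f k))
    [νᶜ]-⋀ : ∀ {I : Set ℓ} (f : I → B.Carrier) →
             [νᶜ] (B.⋀ f) A.≈ A.⋀ (λ k → [νᶜ] (f k))

IsSupported : ∀ {ℓ b₁ b₂} → CompleteHetMAlg ℓ b₁ b₂ → Set ℓ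
IsSupported H = ∀ a → ⟨ν⟩ ([∋] a) A.≈ [νᶜ] (⟨∌⟩ a)
  where open CompleteHetMAlg H

record CompleteHetCAlg (ℓ b₁ b₂ : Level) : Set (suc (ℓ ⊔ b₁ ⊔ b₂)) where
  field
    A : CBA ℓ ℓ ℓ
    B : CBA b₁ b₂ ℓ
  module A = CBA A
  module B = CBA B
  field
    [∋]  : A.Carrier → B.Carrier
    [∌⟩  : A.Carrier → B.Carrier
    _▹_  : B.Carrier → A.Carrier → A.Carrier
    [∋]-cong : ∀ {x y} → x A.≈ y → [∋] x B.≈ [∋] y
    [∌⟩-cong : ∀ {x y} → x A.≈ y → [∌⟩ x B.≈ [∌⟩ y
    ▹-cong   : ∀ {x x' y y'} → x B.≈ x' → y A.≈ y' → (x ▹ y) A.≈ (x' ▹ y')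
    [∋]-⋀  : ∀ {I : Set ℓ} (f : I → A.Carrier) →
             [∋] (A.⋀ f) B.≈ B.⋀ (λ k → [∋] (f k))
    [∌⟩-⋁  : ∀ {I : Set ℓ} (f : I → A.Carrier) →
             [∌⟩ (A.⋁ f) B.≈ B.⋀ (λ k → [∌⟩ (f k))
    ▹-⋁ˡ   : ∀ {I : Set ℓ} (f : I → B.Carrier) (a : A.Carrier) →
             (B.⋁ f ▹ a) A.≈ A.⋀ (λ k → f k ▹ a)
    ▹-⋀ʳ   : ∀ {I : Set ℓ} (b : B.Carrier) (f : I → A.Carrier) →
             (b ▹ A.⋀ f) A.≈ A.⋀ (λ k → b ▹ f k)

record RawHetMAlg (a₁ a₂ b₁ b₂ : Level) : Set (suc (a₁ ⊔ a₂ ⊔ b₁ ⊔ b₂)) where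
  field
    A : RawBA a₁ a₂
    B : RawBA b₁ b₂
  module A = RawBA A
  module B = RawBA B
  field
    [∋]  : A.Carrier → B.Carrier
    ⟨∌⟩  : A.Carrier → B.Carrier
    ⟨ν⟩  : B.Carrier → A.Carrier
    [νᶜ] : B.Carrier → A.Carrier

record RawHetCAlg (a₁ a₂ b₁ b₂ : Level) : Set (suc (a₁ ⊔ a₂ ⊔ b₁ ⊔ b₂)) where
  field
    A : RawBA a₁ a₂
    B : RawBA b₁ b₂
  module A = RawBA A
  module B = RawBA B
  field
    [∋]  : A.Carrier → B.Carrier
    [∌⟩  : A.Carrier → B.Carrier
    _▹_  : B.Carrier → A.Carrier → A.Carrier

rawHM : ∀ {ℓ b₁ b₂} → CompleteHetMAlg ℓ b₁ b₂ → RawHetMAlg ℓ ℓ b₁ b₂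
rawHM H = record
  { A = rawBA A ; B = rawBA B ; [∋] = [∋] ; ⟨∌⟩ = ⟨∌⟩ ; ⟨ν⟩ = ⟨ν⟩ ; [νᶜ] = [νᶜ] }
  where open CompleteHetMAlg H

rawHC : ∀ {ℓ b₁ b₂} → CompleteHetCAlg ℓ b₁ b₂ → RawHetCAlg ℓ ℓ b₁ b₂
rawHC H = record
  { A = rawBA A ; B = rawBA B ; [∋] = [∋] ; [∌⟩ = [∌⟩ ; _▹_ = _▹_ }
  where open CompleteHetCAlg H

record HetMIso {a₁ a₂ b₁ b₂ a₁' a₂' b₁' b₂'}
       (H : RawHetMAlg a₁ a₂ b₁ b₂) (K : RawHetMAlg a₁' a₂' b₁' b₂')
       : Set (a₁ ⊔ a₂ ⊔ b₁ ⊔ b₂ ⊔ a₁' ⊔ a₂' ⊔ b₁' ⊔ b₂') where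
  module H = RawHetMAlg H
  module K = RawHetMAlg K
  field
    isoA : BAIso H.A K.A
    isoB : BAIso H.B K.B
  module fA = BAIso isoA
  module fB = BAIso isoB
  field
    to-[∋]  : ∀ a → fB.to (H.[∋] a) K.B.≈ K.[∋] (fA.to a)
    to-⟨∌⟩  : ∀ a → fB.to (H.⟨∌⟩ a) K.B.≈ K.⟨∌⟩ (fA.to a)
    to-⟨ν⟩  : ∀ b → fA.to (H.⟨ν⟩ b) K.A.≈ K.⟨ν⟩ (fB.to b)
    to-[νᶜ] : ∀ b → fA.to (H.[νᶜ] b) K.A.≈ K.[νᶜ] (fB.to b)

record HetCIso {a₁ a₂ b₁ b₂ a₁' a₂' b₁' b₂'}
       (H : RawHetCAlg a₁ a₂ b₁ b₂) (K : RawHetCAlg a₁' a₂' b₁' b₂')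
       : Set (a₁ ⊔ a₂ ⊔ b₁ ⊔ b₂ ⊔ a₁' ⊔ a₂' ⊔ b₁' ⊔ b₂') where
  module H = RawHetCAlg H
  module K = RawHetCAlg K
  field
    isoA : BAIso H.A K.A
    isoB : BAIso H.B K.B
  module fA = BAIso isoA
  module fB = BAIso isoB
  field
    to-[∋] : ∀ a → fB.to (H.[∋] a) K.B.≈ K.[∋] (fA.to a)
    to-[∌⟩ : ∀ a → fB.to (H.[∌⟩ a) K.B.≈ K.[∌⟩ (fA.to a)
    to-▹   : ∀ b a → fA.to (b H.▹ a) K.A.≈ (fB.to b K.▹ fA.to a)

record Subset {ℓ} (A : CBA ℓ ℓ ℓ) : Set (suc ℓ) where
  open CBA A
  field
    mem  : Carrier → Set ℓ
    resp : ∀ {x y} → x ≈ y → mem x → mem y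
open Subset public

powerset : ∀ {ℓ} → CBA ℓ ℓ ℓ → RawBA (suc ℓ) ℓ
powerset {ℓ} A = record
  { Carrier = Subset A
  ; _≈_ = λ X Y → ∀ x → (mem X x → mem Y x) × (mem Y x → mem X x)
  ; _∧_ = λ X Y → record { mem = λ x → mem X x × mem Y x
                         ; resp = λ e p → resp X e (proj₁ p) , resp Y e (proj₂ p) }
  ; _∨_ = λ X Y → record { mem = λ x → mem X x ⊎ mem Y x
                         ; resp = λ e → Sum.map (resp X e) (resp Y e) }
  ; ¬_  = λ X → record { mem = λ x → Not (mem X x)
                       ; resp = λ e n m → n (resp X (sym e) m) }
  ; ⊤ = record { mem = λ _ → ⊤ℓ ; resp = λ _ t → t }
  ; ⊥ = record { mem = λ _ → ⊥ℓ ; resp = λ _ () }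
  }
  where open CBA A

module _ {ℓ} (A : CBA ℓ ℓ ℓ) where
  open CBA A

  ∋Set : Carrier → Subset A
  ∋Set a = record { mem = λ b → b ≤ a ; resp = ≤-respˡ }

  ∌Set : Carrier → Subset A
  ∌Set a = record { mem = λ b → Not (a ≤ b)
                  ; resp = λ e n p → n (≤-respʳ (sym e) p) }

  ∌⟩Set : Carrier → Subset A
  ∌⟩Set a = record { mem = λ b → a ≤ b ; resp = ≤-respʳ }

  upM : (Carrier → Carrier) → RawHetMAlg ℓ ℓ (suc ℓ) ℓ
  upM ∇ = record
    { A = rawBA A
    ; B = powerset A
    ; [∋]  = ∋Set
    ; ⟨∌⟩  = ∌Set
    ; ⟨ν⟩  = λ X → ⋁ {Σ Carrier (mem X)} (λ p → ∇ (proj₁ p))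
    ; [νᶜ] = λ X → ⋀ {Σ Carrier (λ b → Not (mem X b))} (λ p → ∇ (proj₁ p))
    }

  upC : (Carrier → Carrier → Carrier) → RawHetCAlg ℓ ℓ (suc ℓ) ℓ
  upC _>_ = record
    { A = rawBA A
    ; B = powerset A
    ; [∋] = ∋Set
    ; [∌⟩ = ∌⟩Set
    ; _▹_ = λ X a → ⋀ {Σ Carrier (mem X)} (λ p → proj₁ p > a)
    }

_^•M : ∀ {ℓ} → CompleteMAlg ℓ → RawHetMAlg ℓ ℓ (suc ℓ) ℓ
C ^•M = upM (CompleteMAlg.A C) (CompleteMAlg.∇ C)

_^•C : ∀ {ℓ} → CompleteCAlg ℓ → RawHetCAlg ℓ ℓ (suc ℓ) ℓ
C ^•C = upC (CompleteCAlg.A C) (CompleteCAlg._>_ C)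

-- H_• : ∇a = ⟨ν⟩[∋]a  (= [νᶜ]⟨∌⟩a when H is supported)
_₍•₎M : ∀ {a₁ a₂ b₁ b₂} → RawHetMAlg a₁ a₂ b₁ b₂ → RawMAlg a₁ a₂
H ₍•₎M = record { A = A ; ∇ = λ a → ⟨ν⟩ ([∋] a) }
  where open RawHetMAlg H

_₍•₎C : ∀ {a₁ a₂ b₁ b₂} → RawHetCAlg a₁ a₂ b₁ b₂ → RawCAlg a₁ a₂
H ₍•₎C = record { A = A ; _>_ = λ a b → ([∋] a B.∧ [∌⟩ a) ▹ b }
  where open RawHetCAlg H

_₍•₎^•M : ∀ {ℓ b₁ b₂} → CompleteHetMAlg ℓ b₁ b₂ → RawHetMAlg ℓ ℓ (suc ℓ) ℓ
H ₍•₎^•M = upM (CompleteHetMAlg.A H) (RawMAlg.∇ (rawHM H ₍•₎M))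

_₍•₎^•C : ∀ {ℓ b₁ b₂} → CompleteHetCAlg ℓ b₁ b₂ → RawHetCAlg ℓ ℓ (suc ℓ) ℓ
H ₍•₎^•C = upC (CompleteHetCAlg.A H) (RawCAlg._>_ (rawHC H ₍•₎C))

module Submission where

open import Defs
open import Level using (Level; Lift; lift; lower; _⊔_)
open import Data.Bool using (Bool; true; false; if_then_else_)
open import Data.Product using (Σ; _×_; _,_; proj₁; proj₂; map)
open import Function using (_∘_)
open import Function.Bundles using (_⇔_; mk⇔)
import Algebra.Lattice.Properties.Lattice as LatticeProperties
import Algebra.Lattice.Properties.Semilattice as SemilatticeProperties
import Relation.Binary.Bundles as RB
import Relation.Binary.Reasoning.Setoid as ≈-Reasoning

-- By monotonicity ∇a = ⋁{∇b | b ≤ a}, and since {a} = ↓a ∩ ↑a also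
-- a > b = ⋀{c > b | c ≤ a ≤ c}; so the identity is an isomorphism C ≅ (C^•)_•.
-- If H ≅ C^•, the A-component transports ∇_H = ⟨ν⟩[∋] to ∇_C, hence each
-- operation of H, a join or meet of ∇_C (resp. >_C) over a subset of C,
-- equals the corresponding operation of (H_•)^• once B is identified with
-- P(A) by pulling subsets back along the A-component.  Conversely
-- H ≅ (H_•)^• exhibits H as C^• with C = H_•, which is complete because
-- [∋] and ⟨ν⟩ preserve meets resp. joins and are therefore monotone.

module CBAProperties {c e i} (A : CBA c e i) where
  open CBA A
  private
    module P = RB.Poset (SemilatticeProperties.poset
                 (LatticeProperties.∧-semilattice lattice))

  ≤-refl : ∀ {x} → x ≤ x
  ≤-refl = sym P.refl

  ≤-reflexive : ∀ {x y} → x ≈ y → x ≤ y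
  ≤-reflexive x≈y = sym (P.reflexive x≈y)

  ≤-trans : ∀ {x y z} → x ≤ y → y ≤ z → x ≤ z
  ≤-trans x≤y y≤z = sym (P.trans (sym x≤y) (sym y≤z))

  ≤-antisym : ∀ {x y} → x ≤ y → y ≤ x → x ≈ y
  ≤-antisym x≤y y≤x = P.antisym (sym x≤y) (sym y≤x)

  ⋁-cofinal : ∀ {I J : Set i} (f : I → Carrier) (g : J → Carrier) →
              ((k : I) → Σ J (λ j → f k ≤ g j)) → ⋁ f ≤ ⋁ g
  ⋁-cofinal f g below = ⋁-least f (⋁ g)
    (λ k → ≤-trans (proj₂ (below k)) (⋁-ub g (proj₁ (below k))))

  ⋀-coinitial : ∀ {I J : Set i} (f : I → Carrier) (g : J → Carrier) →
                ((k : J) → Σ I (λ j → f j ≤ g k)) → ⋀ f ≤ ⋀ g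
  ⋀-coinitial f g above = ⋀-greatest g (⋀ f)
    (λ k → ≤-trans (⋀-lb f (proj₁ (above k))) (proj₂ (above k)))

  ⋁-cong : ∀ {I : Set i} {f g : I → Carrier} → (∀ k → f k ≈ g k) → ⋁ f ≈ ⋁ g
  ⋁-cong f≈g = ≤-antisym
    (⋁-cofinal _ _ (λ k → k , ≤-reflexive (f≈g k)))
    (⋁-cofinal _ _ (λ k → k , ≤-reflexive (sym (f≈g k))))

  ⋀-cong : ∀ {I : Set i} {f g : I → Carrier} → (∀ k → f k ≈ g k) → ⋀ f ≈ ⋀ g
  ⋀-cong f≈g = ≤-antisym
    (⋀-coinitial _ _ (λ k → k , ≤-reflexive (f≈g k)))
    (⋀-coinitial _ _ (λ k → k , ≤-reflexive (sym (f≈g k))))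

  pair : Carrier → Carrier → Lift i Bool → Carrier
  pair x y b = if lower b then x else y

  ⋀-pair : ∀ {x y} → x ≤ y → ⋀ (pair x y) ≈ x
  ⋀-pair {x} {y} x≤y = ≤-antisym (⋀-lb (pair x y) (lift true))
    (⋀-greatest (pair x y) x λ { (lift true) → ≤-refl ; (lift false) → x≤y })

  ⋁-pair : ∀ {x y} → x ≤ y → ⋁ (pair x y) ≈ y
  ⋁-pair {x} {y} x≤y = ≤-antisym
    (⋁-least (pair x y) y λ { (lift true) → x≤y ; (lift false) → ≤-refl })
    (⋁-ub (pair x y) (lift false))

module _ {c e c' e' i} (A : CBA c e i) (B : CBA c' e' i) where
  private
    module A = CBA A
    module B = CBA B
  open CBAProperties A using (pair; ⋀-pair; ⋁-pair)

  ⋀-preserving⇒monotone : (f : A.Carrier → B.Carrier) →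
    (∀ {x y} → x A.≈ y → f x B.≈ f y) →
    (∀ {I : Set i} (g : I → A.Carrier) → f (A.⋀ g) B.≈ B.⋀ (f ∘ g)) →
    ∀ {x y} → x A.≤ y → f x B.≤ f y
  ⋀-preserving⇒monotone f f-cong f-⋀ {x} {y} x≤y =
    B.≤-respˡ (B.trans (B.sym (f-⋀ (pair x y))) (f-cong (⋀-pair x≤y)))
              (B.⋀-lb (f ∘ pair x y) (lift false))

  ⋁-preserving⇒monotone : (f : A.Carrier → B.Carrier) →
    (∀ {x y} → x A.≈ y → f x B.≈ f y) →
    (∀ {I : Set i} (g : I → A.Carrier) → f (A.⋁ g) B.≈ B.⋁ (f ∘ g)) →
    ∀ {x y} → x A.≤ y → f x B.≤ f y
  ⋁-preserving⇒monotone f f-cong f-⋁ {x} {y} x≤y =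
    B.≤-respʳ (B.trans (B.sym (f-⋁ (pair x y))) (f-cong (⋁-pair x≤y)))
              (B.⋁-ub (f ∘ pair x y) (lift true))

module BAIsoProperties {c e c' e' i} (A : CBA c e i) (C : CBA c' e' i)
                       (g : BAIso (rawBA A) (rawBA C)) where
  private
    module A = CBA A
    module C = CBA C
    module OC = CBAProperties C
  open BAIso g

  from-∧ : ∀ x y → from (x C.∧ y) A.≈ (from x A.∧ from y)
  from-∧ x y = A.trans
    (from-cong (C.trans (C.∧-cong (C.sym (to-from x)) (C.sym (to-from y)))
                        (C.sym (to-∧ (from x) (from y)))))
    (from-to _)

  to-mono : ∀ {x y} → x A.≤ y → to x C.≤ to y
  to-mono {x} {y} x≤y = C.trans (C.sym (to-∧ x y)) (to-cong x≤y)

  from-mono : ∀ {x y} → x C.≤ y → from x A.≤ from y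
  from-mono {x} {y} x≤y = A.trans (A.sym (from-∧ x y)) (from-cong x≤y)

  to-cancel-≤ : ∀ {x y} → to x C.≤ to y → x A.≤ y
  to-cancel-≤ tx≤ty = A.≤-respʳ (from-to _) (A.≤-respˡ (from-to _) (from-mono tx≤ty))

  to-injective : ∀ {x y} → to x C.≈ to y → x A.≈ y
  to-injective tx≈ty = A.trans (A.sym (from-to _)) (A.trans (from-cong tx≈ty) (from-to _))

  to-⋁ : ∀ {I : Set i} (f : I → A.Carrier) → to (A.⋁ f) C.≈ C.⋁ (to ∘ f)
  to-⋁ f = OC.≤-antisym
    (C.≤-respʳ (to-from _) (to-mono (A.⋁-least f _
       (λ k → A.≤-respˡ (from-to (f k)) (from-mono (C.⋁-ub (to ∘ f) k))))))
    (C.⋁-least _ _ (λ k → to-mono (A.⋁-ub f k)))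

  to-⋀ : ∀ {I : Set i} (f : I → A.Carrier) → to (A.⋀ f) C.≈ C.⋀ (to ∘ f)
  to-⋀ f = OC.≤-antisym
    (C.⋀-greatest _ _ (λ k → to-mono (A.⋀-lb f k)))
    (C.≤-respˡ (to-from _) (to-mono (A.⋀-greatest f _
       (λ k → A.≤-respʳ (from-to (f k)) (from-mono (C.⋀-lb (to ∘ f) k))))))

BAIso-refl : ∀ {c e i} (A : CBA c e i) → BAIso (rawBA A) (rawBA A)
BAIso-refl A = record
  { to = λ x → x ; from = λ x → x ; to-cong = λ e → e ; from-cong = λ e → e
  ; to-from = λ _ → refl ; from-to = λ _ → refl
  ; to-∧ = λ _ _ → refl ; to-∨ = λ _ _ → refl ; to-¬ = λ _ → refl
  ; to-⊤ = refl ; to-⊥ = refl }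
  where open CBA A

infix 4 _⇆_
_⇆_ : ∀ {a b} → Set a → Set b → Set (a ⊔ b)
P ⇆ Q = (P → Q) × (Q → P)

⇆-trans : ∀ {a b c} {P : Set a} {Q : Set b} {R : Set c} → P ⇆ Q → Q ⇆ R → P ⇆ R
⇆-trans (f , f⁻¹) (g , g⁻¹) = g ∘ f , f⁻¹ ∘ g⁻¹

⇆-× : ∀ {a b c d} {P : Set a} {P' : Set b} {Q : Set c} {Q' : Set d} →
      P ⇆ P' → Q ⇆ Q' → (P × Q) ⇆ (P' × Q')
⇆-× (f , f⁻¹) (g , g⁻¹) = map f g , map f⁻¹ g⁻¹

infix 4 _≐_
_≐_ : ∀ {ℓ} {A : CBA ℓ ℓ ℓ} → Subset A → Subset A → Set ℓ
_≐_ {A = A} X Y = ∀ x → mem X x ⇆ mem Y x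

mem-cong : ∀ {ℓ} {A : CBA ℓ ℓ ℓ} (X : Subset A) {x y} →
           CBA._≈_ A x y → mem X x ⇆ mem X y
mem-cong {A = A} X x≈y = resp X x≈y , resp X (CBA.sym A x≈y)

infixr 7 _∩_
_∩_ : ∀ {ℓ} {A : CBA ℓ ℓ ℓ} → Subset A → Subset A → Subset A
_∩_ {A = A} = RawBA._∧_ (powerset A)

∁ : ∀ {ℓ} {A : CBA ℓ ℓ ℓ} → Subset A → Subset A
∁ {A = A} = RawBA.¬_ (powerset A)

module SubsetBounds {c e ℓ} (V : CBA c e ℓ) where
  open CBA V
  open CBAProperties V

  ⋁[_]_ : {A : CBA ℓ ℓ ℓ} → Subset A → (CBA.Carrier A → Carrier) → Carrier
  ⋁[ X ] F = ⋁ {Σ _ (mem X)} (F ∘ proj₁)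

  ⋀[_]_ : {A : CBA ℓ ℓ ℓ} → Subset A → (CBA.Carrier A → Carrier) → Carrier
  ⋀[ X ] F = ⋀ {Σ _ (mem X)} (F ∘ proj₁)

  module _ {A : CBA ℓ ℓ ℓ} (X Y : Subset A) (F : CBA.Carrier A → Carrier) where

    ⋁-subset-cong : X ≐ Y → ⋁[ X ] F ≈ ⋁[ Y ] F
    ⋁-subset-cong X≐Y = ≤-antisym
      (⋁-cofinal _ _ λ { (x , m) → (x , proj₁ (X≐Y x) m) , ≤-refl })
      (⋁-cofinal _ _ λ { (x , m) → (x , proj₂ (X≐Y x) m) , ≤-refl })

    ⋀-subset-cong : X ≐ Y → ⋀[ X ] F ≈ ⋀[ Y ] F
    ⋀-subset-cong X≐Y = ≤-antisym
      (⋀-coinitial _ _ λ { (x , m) → (x , proj₂ (X≐Y x) m) , ≤-refl })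
      (⋀-coinitial _ _ λ { (x , m) → (x , proj₁ (X≐Y x) m) , ≤-refl })

module _ {ℓ} (A : CBA ℓ ℓ ℓ) where
  open CBA A
  open CBAProperties A
  open SubsetBounds A

  monotone⇒≈⋁-downset : (F : Carrier → Carrier) → (∀ {x y} → x ≤ y → F x ≤ F y) →
                        ∀ a → F a ≈ ⋁[ ∋Set A a ] F
  monotone⇒≈⋁-downset F F-mono a = ≤-antisym
    (⋁-ub (F ∘ proj₁) (a , ≤-refl))
    (⋁-least _ _ (F-mono ∘ proj₂))

  cong⇒≈⋀-singleton : (F : Carrier → Carrier) → (∀ {x y} → x ≈ y → F x ≈ F y) →
                      ∀ a → F a ≈ ⋀[ ∋Set A a ∩ ∌⟩Set A a ] F
  cong⇒≈⋀-singleton F F-cong a = ≤-antisym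
    (⋀-greatest _ _ λ { (x , x≤a , a≤x) →
        ≤-reflexive (F-cong (≤-antisym a≤x x≤a)) })
    (⋀-lb (F ∘ proj₁) (a , ≤-refl , ≤-refl))

module Pullback {ℓ} {A C : CBA ℓ ℓ ℓ} (g : BAIso (rawBA A) (rawBA C)) where
  private
    module C = CBA C
    module g = BAIso g

  pullback : Subset C → Subset A
  pullback X = record { mem = mem X ∘ g.to ; resp = resp X ∘ g.to-cong }

  pushforward : Subset A → Subset C
  pushforward Y = record { mem = mem Y ∘ g.from ; resp = resp Y ∘ g.from-cong }

  open BAIsoProperties A C g using (to-mono; to-cancel-≤)

  pullback-∋Set : ∀ a → pullback (∋Set C (g.to a)) ≐ ∋Set A a
  pullback-∋Set a _ = to-cancel-≤ , to-mono

  pullback-∌Set : ∀ a → pullback (∌Set C (g.to a)) ≐ ∌Set A a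
  pullback-∌Set a _ = (λ n → n ∘ to-mono) , (λ n → n ∘ to-cancel-≤)

  pullback-∌⟩Set : ∀ a → pullback (∌⟩Set C (g.to a)) ≐ ∌⟩Set A a
  pullback-∌⟩Set a _ = to-cancel-≤ , to-mono

  module _ {c e} (V : CBA c e ℓ) (X : Subset C) {F : C.Carrier → CBA.Carrier V}
           (F-cong : ∀ {x y} → x C.≈ y → CBA._≈_ V (F x) (F y)) where
    open CBA V
    open CBAProperties V
    open SubsetBounds V

    private
      F-to-from : ∀ x → F (g.to (g.from x)) ≈ F x
      F-to-from x = F-cong (g.to-from x)

      mem-to-from : ∀ {x} → mem X x → mem X (g.to (g.from x))
      mem-to-from = resp X (C.sym (g.to-from _))

    ⋁-reindex : ⋁[ X ] F ≈ ⋁[ pullback X ] (F ∘ g.to)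
    ⋁-reindex = ≤-antisym
      (⋁-cofinal _ _ λ { (x , m) →
          (g.from x , mem-to-from m) , ≤-reflexive (sym (F-to-from x)) })
      (⋁-cofinal _ _ λ { (a , m) → (g.to a , m) , ≤-refl })

    ⋀-reindex : ⋀[ X ] F ≈ ⋀[ pullback X ] (F ∘ g.to)
    ⋀-reindex = ≤-antisym
      (⋀-coinitial _ _ λ { (a , m) → (g.to a , m) , ≤-refl })
      (⋀-coinitial _ _ λ { (x , m) →
          (g.from x , mem-to-from m) , ≤-reflexive (F-to-from x) })

  transport-powerset : ∀ {b₁ b₂} {B : CBA b₁ b₂ ℓ} →
    BAIso (rawBA B) (powerset C) → BAIso (rawBA B) (powerset A)
  transport-powerset {B = B} h = record
    { to = pullback ∘ h.to
    ; from = h.from ∘ pushforward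
    ; to-cong = λ x≈y → h.to-cong x≈y ∘ g.to
    ; from-cong = λ X≐Y → h.from-cong (X≐Y ∘ g.from)
    ; to-from = λ Y a →
        ⇆-trans (h.to-from (pushforward Y) (g.to a)) (mem-cong Y (g.from-to a))
    ; from-to = λ b → B.trans (h.from-cong (mem-cong (h.to b) ∘ g.to-from)) (h.from-to b)
    ; to-∧ = λ x y → h.to-∧ x y ∘ g.to
    ; to-∨ = λ x y → h.to-∨ x y ∘ g.to
    ; to-¬ = λ x → h.to-¬ x ∘ g.to
    ; to-⊤ = h.to-⊤ ∘ g.to
    ; to-⊥ = h.to-⊥ ∘ g.to
    }
    where
    module B = CBA B
    module h = BAIso h

C≅C^•₍•₎M : ∀ {ℓ} (C : CompleteMAlg ℓ) → MIso (rawM C) ((C ^•M) ₍•₎M)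
C≅C^•₍•₎M C = record
  { iso = BAIso-refl A ; to-∇ = monotone⇒≈⋁-downset A ∇ ∇-mono }
  where open CompleteMAlg C

C≅C^•₍•₎C : ∀ {ℓ} (C : CompleteCAlg ℓ) → CIso (rawC C) ((C ^•C) ₍•₎C)
C≅C^•₍•₎C C = record
  { iso = BAIso-refl A
  ; to-> = λ a b → cong⇒≈⋀-singleton A (_> b) (λ x≈y → >-cong x≈y (CBA.refl A)) a
  }
  where open CompleteCAlg C

lowerM : ∀ {ℓ b₁ b₂} → CompleteHetMAlg ℓ b₁ b₂ → CompleteMAlg ℓ
lowerM H = record
  { A = A
  ; ∇ = ⟨ν⟩ ∘ [∋]
  ; ∇-cong = λ x≈y → ⟨ν⟩-cong ([∋]-cong x≈y)
  ; ∇-mono = λ x≤y → ⋁-preserving⇒monotone B A ⟨ν⟩ ⟨ν⟩-cong ⟨ν⟩-⋁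
                       (⋀-preserving⇒monotone A B [∋] [∋]-cong [∋]-⋀ x≤y)
  }
  where open CompleteHetMAlg H

lowerC : ∀ {ℓ b₁ b₂} → CompleteHetCAlg ℓ b₁ b₂ → CompleteCAlg ℓ
lowerC H = record
  { A = A
  ; _>_ = λ a b → ([∋] a B.∧ [∌⟩ a) ▹ b
  ; >-cong = λ x≈x' y≈y' →
      ▹-cong (B.∧-cong ([∋]-cong x≈x') ([∌⟩-cong x≈x')) y≈y'
  ; >-⋀ = λ a → ▹-⋀ʳ ([∋] a B.∧ [∌⟩ a)
  }
  where open CompleteHetCAlg H

module _ {ℓ b₁ b₂} (H : CompleteHetMAlg ℓ b₁ b₂) (C : CompleteMAlg ℓ)
         (g : HetMIso (rawHM H) (C ^•M)) where
  private
    open CompleteHetMAlg H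
    module C = CompleteMAlg C
    module CA = CBA C.A
    module G = HetMIso g
    gA = G.isoA
    module gA = BAIso gA
    module gB = BAIso G.isoB
    open BAIsoProperties A C.A gA
    open SubsetBounds C.A
    open CBAProperties C.A using (⋁-cong; ⋀-cong)
    open Pullback {A = A} {C = C.A} gA
    open ≈-Reasoning CA.setoid

    ∇H : A.Carrier → A.Carrier
    ∇H = ⟨ν⟩ ∘ [∋]

  ∇-transport : ∀ a → gA.to (∇H a) CA.≈ C.∇ (gA.to a)
  ∇-transport a = begin
    gA.to (⟨ν⟩ ([∋] a))
      ≈⟨ G.to-⟨ν⟩ ([∋] a) ⟩
    ⋁[ gB.to ([∋] a) ] C.∇
      ≈⟨ ⋁-subset-cong (gB.to ([∋] a)) (∋Set C.A (gA.to a)) C.∇ (G.to-[∋] a) ⟩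
    ⋁[ ∋Set C.A (gA.to a) ] C.∇
      ≈⟨ monotone⇒≈⋁-downset C.A C.∇ C.∇-mono (gA.to a) ⟨
    C.∇ (gA.to a) ∎

  H≅H₍•₎^•M : HetMIso (rawHM H) (H ₍•₎^•M)
  H≅H₍•₎^•M = record
    { isoA = BAIso-refl A
    ; isoB = transport-powerset {B = B} G.isoB
    ; to-[∋] = λ a x → ⇆-trans (G.to-[∋] a (gA.to x)) (pullback-∋Set a x)
    ; to-⟨∌⟩ = λ a x → ⇆-trans (G.to-⟨∌⟩ a (gA.to x)) (pullback-∌Set a x)
    ; to-⟨ν⟩ = λ b → to-injective (begin
        gA.to (⟨ν⟩ b)
          ≈⟨ G.to-⟨ν⟩ b ⟩
        ⋁[ gB.to b ] C.∇
          ≈⟨ ⋁-reindex C.A (gB.to b) C.∇-cong ⟩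
        ⋁[ pullback (gB.to b) ] (C.∇ ∘ gA.to)
          ≈⟨ ⋁-cong (CA.sym ∘ ∇-transport ∘ proj₁) ⟩
        ⋁[ pullback (gB.to b) ] (gA.to ∘ ∇H)
          ≈⟨ to-⋁ (∇H ∘ proj₁) ⟨
        gA.to (A.⋁ (∇H ∘ proj₁)) ∎)
    ; to-[νᶜ] = λ b → to-injective (begin
        gA.to ([νᶜ] b)
          ≈⟨ G.to-[νᶜ] b ⟩
        ⋀[ ∁ (gB.to b) ] C.∇
          ≈⟨ ⋀-reindex C.A (∁ (gB.to b)) C.∇-cong ⟩
        ⋀[ pullback (∁ (gB.to b)) ] (C.∇ ∘ gA.to)
          ≈⟨ ⋀-cong (CA.sym ∘ ∇-transport ∘ proj₁) ⟩
        ⋀[ pullback (∁ (gB.to b)) ] (gA.to ∘ ∇H)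
          ≈⟨ to-⋀ (∇H ∘ proj₁) ⟨
        gA.to (A.⋀ (∇H ∘ proj₁)) ∎)
    }

module _ {ℓ b₁ b₂} (H : CompleteHetCAlg ℓ b₁ b₂) (C : CompleteCAlg ℓ)
         (g : HetCIso (rawHC H) (C ^•C)) where
  private
    open CompleteHetCAlg H
    module C = CompleteCAlg C
    module CA = CBA C.A
    module G = HetCIso g
    gA = G.isoA
    module gA = BAIso gA
    module gB = BAIso G.isoB
    open BAIsoProperties A C.A gA
    open SubsetBounds C.A
    open CBAProperties C.A using (⋀-cong)
    open Pullback {A = A} {C = C.A} gA
    open ≈-Reasoning CA.setoid

    _>H_ : A.Carrier → A.Carrier → A.Carrier
    a' >H a = ([∋] a' B.∧ [∌⟩ a') ▹ a

    >C-congˡ : ∀ {x y} c → x CA.≈ y → (x C.> c) CA.≈ (y C.> c)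
    >C-congˡ c x≈y = C.>-cong x≈y CA.refl

  >-transport : ∀ a' a → gA.to (a' >H a) CA.≈ (gA.to a' C.> gA.to a)
  >-transport a' a = begin
    gA.to (⋂a' ▹ a)
      ≈⟨ G.to-▹ ⋂a' a ⟩
    ⋀[ gB.to ⋂a' ] (C._> ta)
      ≈⟨ ⋀-subset-cong (gB.to ⋂a') (∋Set C.A ta' ∩ ∌⟩Set C.A ta') (C._> ta) to-⋂a' ⟩
    ⋀[ ∋Set C.A ta' ∩ ∌⟩Set C.A ta' ] (C._> ta)
      ≈⟨ cong⇒≈⋀-singleton C.A (C._> ta) (>C-congˡ ta) ta' ⟨
    ta' C.> ta ∎
    where
    ta' ta : CA.Carrier
    ta' = gA.to a'
    ta  = gA.to a
    ⋂a' : B.Carrier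
    ⋂a' = [∋] a' B.∧ [∌⟩ a'
    to-⋂a' : gB.to ⋂a' ≐ ∋Set C.A ta' ∩ ∌⟩Set C.A ta'
    to-⋂a' x = ⇆-trans (gB.to-∧ ([∋] a') ([∌⟩ a') x)
                       (⇆-× (G.to-[∋] a' x) (G.to-[∌⟩ a' x))

  H≅H₍•₎^•C : HetCIso (rawHC H) (H ₍•₎^•C)
  H≅H₍•₎^•C = record
    { isoA = BAIso-refl A
    ; isoB = transport-powerset {B = B} G.isoB
    ; to-[∋] = λ a x → ⇆-trans (G.to-[∋] a (gA.to x)) (pullback-∋Set a x)
    ; to-[∌⟩ = λ a x → ⇆-trans (G.to-[∌⟩ a (gA.to x)) (pullback-∌⟩Set a x)
    ; to-▹ = λ b a → to-injective (begin
        gA.to (b ▹ a)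
          ≈⟨ G.to-▹ b a ⟩
        ⋀[ gB.to b ] (C._> gA.to a)
          ≈⟨ ⋀-reindex C.A (gB.to b) (>C-congˡ (gA.to a)) ⟩
        ⋀[ pullback (gB.to b) ] (λ a' → gA.to a' C.> gA.to a)
          ≈⟨ ⋀-cong (λ p → CA.sym (>-transport (proj₁ p) a)) ⟩
        ⋀[ pullback (gB.to b) ] (λ a' → gA.to (a' >H a))
          ≈⟨ to-⋀ (λ p → proj₁ p >H a) ⟨
        gA.to (A.⋀ (λ p → proj₁ p >H a)) ∎)
    }

mainTheorem6 : {ℓ b₁ b₂ : Level} →
    ((C : CompleteMAlg ℓ) → MIso (rawM C) ((C ^•M) ₍•₎M))
    × ((C : CompleteCAlg ℓ) → CIso (rawC C) ((C ^•C) ₍•₎C))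
    × ((H : CompleteHetMAlg ℓ b₁ b₂) → IsSupported H →
         (Σ (CompleteMAlg ℓ) (λ C → HetMIso (rawHM H) (C ^•M)))
           ⇔ HetMIso (rawHM H) (H ₍•₎^•M))
    × ((H : CompleteHetCAlg ℓ b₁ b₂) →
         (Σ (CompleteCAlg ℓ) (λ C → HetCIso (rawHC H) (C ^•C)))
           ⇔ HetCIso (rawHC H) (H ₍•₎^•C))
mainTheorem6 =
    C≅C^•₍•₎M
  , C≅C^•₍•₎C
  , (λ H _ → mk⇔ (λ (C , H≅C^•) → H≅H₍•₎^•M H C H≅C^•)
                  (λ H≅H₍•₎^• → lowerM H , H≅H₍•₎^•))
  , (λ H → mk⇔ (λ (C , H≅C^•) → H≅H₍•₎^•C H C H≅C^•)
                (λ H≅H₍•₎^• → lowerC H , H≅H₍•₎^•))
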